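{- Let $(\mathcal{R},W)$ be a Strip Packing instance, run the Bottom-Left algorithm with the $\mathcal{FQW}$-ordering $r_1,\dots,r_n$, let $a=|\mathcal{F}|$, assume $\mathcal{Q}\neq\emptyset$ and $\max\{y_r+h_r:r\in\mathcal{Q}\}>h_{\max}$, and let $L$ be the index of the left rectangle $r_L$ of $\mathcal{Q}$. Let $\ell$ be a proper horizontal line in $H_{a+2}\cup\cdots\cup H_L$. Then $LM(\ell)$ has a rectangle from $\mathcal{F}$ as a left supporter.
   Context: Strip Packing: an instance $(\mathcal{R},W)$ consists of a strip $[0,W]\times[0,\infty)$ with $W>0$ and a finite set $\mathcal{R}$ of $n$ axis-parallel closed rectangles; rectangle $r$ has width $w_r\in(0,W]$ and height $h_r>0$; $h_{\max}=\max_r h_r$. A packing assigns to each $r$ a lower-left corner $(x_r,y_r)$; it is feasible if $x_r\ge0$, $x_r+w_r\le W$, $y_r\ge0$ and the open rectangles $(x_r,x_r+w_r)\times(y_r,y_r+h_r)$ are pairwise disjoint; no rotations. Bottom-Left (BL) algorithm: given an ordering $r_1,\dots,r_n$, place $r_1$ at $(0,0)$; for $i\ge2$ choose $(x_{r_i},y_{r_i})$ such that $r_1,\dots,r_i$ form a feasible packing and $(y_{r_i},x_{r_i})$ is lexicographically minimal. A left supporter of $r_i$ is a rectangle $r_j$ with $j<i$ whose right face touches the left face of $r_i$: $x_{r_j}+w_{r_j}=x_{r_i}$ and the $y$-intervals $(y_{r_j},y_{r_j}+h_{r_j})$, $(y_{r_i},y_{r_i}+h_{r_i})$ intersect. $\mathcal{FQW}$-partition: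 go through the rectangles in order of non-increasing height (ties arbitrary), adding $r$ to $\mathcal{F}$ (initially empty) iff $w_r+\sum_{f\in\mathcal{F}}w_f\le W$; $\mathcal{W}=\{r\in\mathcal{R}\setminus\mathcal{F}:w_r>W/2\}$, $\mathcal{Q}=\mathcal{R}\setminus(\mathcal{F}\cup\mathcal{W})$. The $\mathcal{FQW}$-ordering lists $\mathcal{F}$ by non-increasing height, then $\mathcal{Q}$ by non-increasing width, then $\mathcal{W}$ in any order; ties arbitrary; so $\mathcal{F}=\{r_1,\dots,r_a\}$ and $\mathcal{Q}=\{r_{a+1},\dots,r_{a+|\mathcal{Q}|}\}$. The top rectangle $r_T$ of $\mathcal{Q}$ is a rectangle of $\mathcal{Q}$ with highest top face $y_r+h_r$, ties broken by highest bottom face. The left rectangle $r_L$ of $\mathcal{Q}$ is the first rectangle of $\mathcal{Q}$ in the ordering with $x_r=0$; if none, $r_L:=r_T$; $L$ is its index. Horizontal strip partition: $H_i=[0,W]\times[\max\{y_{r_1},\dots,y_{r_{i-1}}\},\,y_{r_i})$ for $1\le i\le n$ (with $\max\emptyset=0$ and $[s,t)=\emptyset$ if $t\le s$). A horizontal line $\{(x,c):0\le x\le W\}$ is proper if $c\notin\{y_r,y_r+h_r:r\in\mathcal{R}\}$. A rectangle $r$ is above $\ell$ if $y_r>c$. The type $T(\ell)$ of a proper line $\ell$ is the set of rectangles of $\mathcal{Q}$ that intersect $\ell$ and are placed before the first rectangle (in the ordering) that lies above $\ell$; $LM(\ell)$ is the leftmost rectangle of $T(\ell)$.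
   Formalization: The strip width $W$, the widths and heights of the rectangles, the placement coordinates and the height of each horizontal line are all rational. -}

module Defs where

open import Data.Nat as ℕ using (ℕ)
open import Data.Fin using (Fin; toℕ)
open import Data.Fin.Base using () renaming (_<_ to _<ᶠ_; _≤_ to _≤ᶠ_)
open import Data.Rational using (ℚ; 0ℚ; _+_; _*_; _≤_; _<_; _⊔_; ½; _≤ᵇ_)
open import Data.List using (List; []; _∷_; foldr; map)
open import Data.List.Membership.Propositional using (_∈_)
open import Data.List.Relation.Unary.Linked using (Linked)
open import Data.List.Relation.Binary.Permutation.Propositional using (_↭_)
open import Data.Bool using (Bool; if_then_else_)
open import Data.Nat.Base using (_<ᵇ_)
open import Data.List using () renaming (allFin to allFinL)
open import Data.Product using (Σ; ∃; _×_; _,_)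
open import Data.Sum using (_⊎_)
open import Relation.Nullary using (¬_)
open import Relation.Binary.PropositionalEquality using (_≡_; _≢_)
open import Function.Bundles using (_⇔_)

-- A Strip Packing instance with n rectangles, listed in the order r₁,…,rₙ
-- (rectangle r_{k+1} is the index k : Fin n).  Coordinates are rationals.
module Strip {n : ℕ} (W : ℚ) (w h : Fin n → ℚ) where

  ValidInstance : Set
  ValidInstance = (0ℚ < W) × (∀ r → (0ℚ < w r) × (w r ≤ W)) × (∀ r → 0ℚ < h r)

  hmax : ℚ
  hmax = foldr (λ r acc → h r ⊔ acc) 0ℚ (allFinL n)

  greedy : ℚ → List (Fin n) → List (Fin n)
  greedy s [] = []
  greedy s (r ∷ rs) =
    if (w r + s) ≤ᵇ W then r ∷ greedy (s + w r) rs else greedy s rs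

  HeightOrder : List (Fin n) → Set
  HeightOrder σ = (σ ↭ allFinL n) × Linked (λ i j → h j ≤ h i) σ

  -- F = { r : toℕ r < a } for a the number of F rectangles (F is listed first)
  inF : ℕ → Fin n → Set
  inF a r = toℕ r ℕ.< a

  inWide : ℕ → Fin n → Set
  inWide a r = ¬ inF a r × (½ * W < w r)

  inQ : ℕ → Fin n → Set
  inQ a r = ¬ inF a r × ¬ (½ * W < w r)

  IsFQWOrdering : ℕ → Set
  IsFQWOrdering a =
    (Σ (List (Fin n)) λ σ → HeightOrder σ × (∀ r → (r ∈ greedy 0ℚ σ) ⇔ inF a r))
    × (∀ i j → inF a i → inF a j → i <ᶠ j → h j ≤ h i)
    × (∀ i j → inQ a i → inQ a j → i <ᶠ j → w j ≤ w i)
    × (∀ i j → inQ a i → inWide a j → i <ᶠ j)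

  -- Packings (x r , y r) = lower-left corner of r
  module Packing (x y : Fin n → ℚ) where

    OpenOverlap : Fin n → ℚ → ℚ → Fin n → Set
    OpenOverlap r X Y j = ∃ λ p → ∃ λ q →
      (X < p × p < X + w r × Y < q × q < Y + h r) ×
      (x j < p × p < x j + w j × y j < q × q < y j + h j)

    FeasibleAt : Fin n → ℚ → ℚ → Set
    FeasibleAt r X Y =
      (0ℚ ≤ X) × (X + w r ≤ W) × (0ℚ ≤ Y) ×
      (∀ j → j <ᶠ r → ¬ OpenOverlap r X Y j)

    LexLE : ℚ → ℚ → ℚ → ℚ → Set
    LexLE Y X Y' X' = (Y < Y') ⊎ ((Y ≡ Y') × (X ≤ X'))

    IsBL : Set
    IsBL = ∀ r → FeasibleAt r (x r) (y r) ×
                 (∀ X Y → FeasibleAt r X Y → LexLE (y r) (x r) Y X)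

    top : Fin n → ℚ
    top r = y r + h r

    IsTop : ℕ → Fin n → Set
    IsTop a t = inQ a t × (∀ r → inQ a r →
      (top r < top t) ⊎ ((top r ≡ top t) × (y r ≤ y t)))

    IsLeft : ℕ → Fin n → Set
    IsLeft a l =
      (inQ a l × x l ≡ 0ℚ × (∀ j → inQ a j → x j ≡ 0ℚ → l ≤ᶠ j))
      ⊎ ((∀ j → inQ a j → x j ≢ 0ℚ) × IsTop a l)

    -- max{ y_{r_1},…,y_{r_{i-1}} } (0 if empty), for the 0-based index k = i-1
    maxPrev : Fin n → ℚ
    maxPrev k = foldr (λ j acc → if toℕ j <ᵇ toℕ k then y j ⊔ acc else acc)
                      0ℚ (allFinL n)

    -- the line at height c lies in H_{k+1} (k 0-based)
    InStrip : Fin n → ℚ → Set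
    InStrip k c = (maxPrev k ≤ c) × (c < y k)

    Proper : ℚ → Set
    Proper c = ∀ r → (c ≢ y r) × (c ≢ y r + h r)

    InType : ℕ → ℚ → Fin n → Set
    InType a c r = inQ a r × (y r ≤ c × c ≤ y r + h r) ×
                   (∀ j → c < y j → r <ᶠ j)

    IsLM : ℕ → ℚ → Fin n → Set
    IsLM a c m = InType a c m × (∀ s → InType a c s → x m ≤ x s)

    LeftSupporter : Fin n → Fin n → Set
    LeftSupporter j m = j <ᶠ m × (x j + w j ≡ x m) ×
      (∃ λ q → (y j < q × q < y j + h j) × (y m < q × q < y m + h m))

{-# OPTIONS --safe #-}
-- The rectangles of F have total width at most W, so BL puts them side by side on the floor.
-- LM(ℓ) is placed before the left rectangle r_L, hence away from the left wall, and a rectangle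
-- placed by BL away from the wall has a left supporter, since otherwise it could slide left.
-- Suppose this supporter j is in Q. Then j lies below ℓ (otherwise j ∈ T(ℓ) would lie left of
-- LM(ℓ)), and the first rectangle r_k above ℓ, which is no wider than LM(ℓ) and hence than j,
-- fits at (x_j, c): a Q-rectangle in its way would be in T(ℓ) and lie left of LM(ℓ), and an
-- F-rectangle in its way stands on the floor, reaches above ℓ and so would overlap j.
-- Hence BL would have placed r_k lower than it did.
module Submission where

open import Defs
open import Data.Nat using (ℕ; suc; _≤_)
open import Data.Fin using (Fin; toℕ)
open import Data.Rational using (ℚ; _<_)
open import Data.Product using (Σ; ∃; _×_)

open import Algebra.Bundles using (CommutativeMonoid)
open import Data.Bool using (true; false; if_then_else_; T)
open import Data.Empty using (⊥-elim)
open import Data.Fin.Base using (fromℕ<) renaming (_<_ to _<ᶠ_)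
import Data.Fin.Induction as Fin
import Data.Fin.Properties as Finₚ
open import Data.List using (List; []; _∷_; foldr; allFin)
open import Data.List.Membership.Propositional using (_∈_)
open import Data.List.Membership.Propositional.Properties using (∈-allFin)
open import Data.List.Relation.Unary.Any using (here; there)
open import Data.Nat as ℕ using (zero)
import Data.Nat.Properties as ℕₚ
open import Data.Product using (_,_; proj₁; proj₂)
open import Data.Rational using (0ℚ; _+_; _⊔_; _⊓_; _≤ᵇ_) renaming (_≤_ to _≤ℚ_)
open import Data.Rational.Properties
open import Data.Sum using (_⊎_; inj₁; inj₂; [_,_]′)
open import Data.Unit using (tt)
open import Function.Bundles using (Equivalence)
open import Induction.WellFounded using (WfRec; module All)
open import Level using (0ℓ)
open import Relation.Binary.Definitions using (tri<; tri≈; tri>)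
open import Relation.Binary.PropositionalEquality using (_≡_; _≢_; refl; sym; trans; cong; subst)
open import Relation.Nullary using (¬_; yes; no)

open import Algebra.Properties.CommutativeSemigroup (CommutativeMonoid.commutativeSemigroup +-0-commutativeMonoid)
  using (x∙yz≈y∙xz)

p<p+q : ∀ p {q} → 0ℚ < q → p < p + q
p<p+q p {q} 0<q = subst (_< p + q) (+-identityʳ p) (+-monoʳ-< p 0<q)

⊔-<-lub : ∀ {p q r} → p < r → q < r → p ⊔ q < r
⊔-<-lub {p} {q} p<r q<r with ⊔-sel p q
... | inj₁ p⊔q≡p = subst (_< _) (sym p⊔q≡p) p<r
... | inj₂ p⊔q≡q = subst (_< _) (sym p⊔q≡q) q<r

⊓-<-glb : ∀ {p q r} → r < p → r < q → r < p ⊓ q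
⊓-<-glb {p} {q} r<p r<q with ⊓-sel p q
... | inj₁ p⊓q≡p = subst (_ <_) (sym p⊓q≡p) r<p
... | inj₂ p⊓q≡q = subst (_ <_) (sym p⊓q≡q) r<q

intervals-meet : ∀ {a b c d} → a < b → c < d → a < d → c < b →
                 ∃ λ p → (a < p × p < b) × (c < p × p < d)
intervals-meet {a} {b} {c} {d} a<b c<d a<d c<b
  with p , a⊔c<p , p<b⊓d ← <-dense (⊔-<-lub (⊓-<-glb a<b a<d) (⊓-<-glb c<b c<d)) =
  p , (≤-<-trans (p≤p⊔q a c) a⊔c<p , <-≤-trans p<b⊓d (p⊓q≤p b d))
    , (≤-<-trans (p≤q⊔p a c) a⊔c<p , <-≤-trans p<b⊓d (p⊓q≤q b d))

≤-if-⊔ : ∀ b u {s} → s ≤ℚ (if b then u ⊔ s else s)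
≤-if-⊔ true  u {s} = p≤q⊔p u s
≤-if-⊔ false _ = ≤-refl

T⇒≤-if-⊔ : ∀ {b u s} → T b → u ≤ℚ (if b then u ⊔ s else s)
T⇒≤-if-⊔ {true} {u} {s} _ = p≤p⊔q u s

module PrefixSums {n : ℕ} (f : Fin n → ℚ) where

  sumOver : List (Fin n) → ℚ
  sumOver = foldr (λ i s → f i + s) 0ℚ

  fℕ : ℕ → ℚ
  fℕ t with t ℕ.<? n
  ... | yes t<n = f (fromℕ< t<n)
  ... | no  _   = 0ℚ

  prefixSum : ℕ → ℚ
  prefixSum zero    = 0ℚ
  prefixSum (suc t) = prefixSum t + fℕ t

  fℕ-toℕ : ∀ i → fℕ (toℕ i) ≡ f i
  fℕ-toℕ i with toℕ i ℕ.<? n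
  ... | yes i<n = cong f (Finₚ.fromℕ<-toℕ i i<n)
  ... | no  i≮n = ⊥-elim (i≮n (Finₚ.toℕ<n i))

  prefixSum-suc : ∀ i → prefixSum (suc (toℕ i)) ≡ prefixSum (toℕ i) + f i
  prefixSum-suc i = cong (prefixSum (toℕ i) +_) (fℕ-toℕ i)

  sumOver-remove : ∀ {i is} → i ∈ is →
              ∃ λ js → (sumOver is ≡ f i + sumOver js) × (∀ j → j ∈ is → j ≢ i → j ∈ js)
  sumOver-remove {is = _ ∷ is} (here refl) =
    is , refl , λ { j (here j≡i) j≢i → ⊥-elim (j≢i j≡i) ; j (there j∈is) _ → j∈is }
  sumOver-remove {i} {is = g ∷ is} (there i∈is) with js , split , keeps ← sumOver-remove i∈is =
    g ∷ js , trans (cong (f g +_) split) (x∙yz≈y∙xz (f g) (f i) (sumOver js)) ,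
    λ { j (here j≡g) _ → here j≡g ; j (there j∈is) j≢i → there (keeps j j∈is j≢i) }

  module _ (f≥0 : ∀ i → 0ℚ ≤ℚ f i) where

    fℕ-nonneg : ∀ t → 0ℚ ≤ℚ fℕ t
    fℕ-nonneg t with t ℕ.<? n
    ... | yes t<n = f≥0 (fromℕ< t<n)
    ... | no  _   = ≤-refl

    prefixSum-≤-suc : ∀ t → prefixSum t ≤ℚ prefixSum (suc t)
    prefixSum-≤-suc t = subst (_≤ℚ prefixSum (suc t)) (+-identityʳ _) (+-monoʳ-≤ (prefixSum t) (fℕ-nonneg t))

    prefixSum-mono : ∀ {t u} → t ≤ u → prefixSum t ≤ℚ prefixSum u
    prefixSum-mono {u = zero}  ℕ.z≤n = ≤-refl
    prefixSum-mono {t} {suc u} t≤1+u with ℕₚ.m≤n⇒m<n∨m≡n t≤1+u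
    ... | inj₁ t<1+u = ≤-trans (prefixSum-mono (ℕ.s≤s⁻¹ t<1+u)) (prefixSum-≤-suc u)
    ... | inj₂ refl  = ≤-refl

    sumOver-nonneg : ∀ is → 0ℚ ≤ℚ sumOver is
    sumOver-nonneg []       = ≤-refl
    sumOver-nonneg (i ∷ is) = subst (_≤ℚ f i + sumOver is) (+-identityʳ 0ℚ) (+-mono-≤ (f≥0 i) (sumOver-nonneg is))

    prefixSum≤sumOver : ∀ t is → (∀ i → toℕ i ℕ.< t → i ∈ is) → prefixSum t ≤ℚ sumOver is
    prefixSum≤sumOver zero    is _      = sumOver-nonneg is
    prefixSum≤sumOver (suc t) is covers with t ℕ.<? n
    ... | no t≮n = begin
      prefixSum t + 0ℚ    ≡⟨ +-identityʳ _ ⟩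
      prefixSum t         ≤⟨ prefixSum≤sumOver t is (λ i i<t → covers i (ℕₚ.m<n⇒m<1+n i<t)) ⟩
      sumOver is          ∎
      where open ≤-Reasoning
    ... | yes t<n with js , split , keeps ← sumOver-remove (covers (fromℕ< t<n) (ℕₚ.≤-reflexive (cong suc (Finₚ.toℕ-fromℕ< t<n)))) = begin
      prefixSum t + f (fromℕ< t<n)    ≤⟨ +-monoˡ-≤ _ (prefixSum≤sumOver t js earlier-in-js) ⟩
      sumOver js + f (fromℕ< t<n)     ≡⟨ +-comm (sumOver js) _ ⟩
      f (fromℕ< t<n) + sumOver js     ≡⟨ sym split ⟩
      sumOver is                      ∎
      where
        open ≤-Reasoning
        earlier-in-js : ∀ i → toℕ i ℕ.< t → i ∈ js
        earlier-in-js i i<t = keeps i (covers i (ℕₚ.m<n⇒m<1+n i<t))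
          (λ i≡t → ℕₚ.<-irrefl (trans (cong toℕ i≡t) (Finₚ.toℕ-fromℕ< t<n)) i<t)

module _ {n : ℕ} (W : ℚ) (w h : Fin n → ℚ) where
  open Strip W w h
  open PrefixSums w

  greedy-fits : ∀ s rs → s ≤ℚ W → s + sumOver (greedy s rs) ≤ℚ W
  greedy-fits s []       s≤W = subst (_≤ℚ W) (sym (+-identityʳ s)) s≤W
  greedy-fits s (r ∷ rs) s≤W with (w r + s) ≤ᵇ W in r-fits
  ... | true  = subst (_≤ℚ W) (+-assoc s (w r) _) (greedy-fits (s + w r) rs s+wr≤W)
    where
      s+wr≤W : s + w r ≤ℚ W
      s+wr≤W = subst (_≤ℚ W) (+-comm (w r) s) (≤ᵇ⇒≤ (subst T (sym r-fits) tt))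
  ... | false = greedy-fits s rs s≤W

  module Geometry (x y : Fin n → ℚ) where
    open Packing x y

    Crossing : Fin n → ℚ → ℚ → Fin n → Set
    Crossing r X Y j = (x j < X + w r × X < x j + w j) × (y j < Y + h r × Y < y j + h j)

    overlap⇒crossing : ∀ {r X Y j} → OpenOverlap r X Y j → Crossing r X Y j
    overlap⇒crossing (_ , _ , (X<p , p<X+w , Y<q , q<Y+h) , (xj<p , p<xj+w , yj<q , q<yj+h)) =
      (<-trans xj<p p<X+w , <-trans X<p p<xj+w) , (<-trans yj<q q<Y+h , <-trans Y<q q<yj+h)

    y≤maxPrev : ∀ {j k} → j <ᶠ k → y j ≤ℚ maxPrev k
    y≤maxPrev {j} {k} j<k = go (allFin n) (∈-allFin j)
      where
        go : ∀ js → j ∈ js → y j ≤ℚ foldr (λ i s → if toℕ i ℕ.<ᵇ toℕ k then y i ⊔ s else s) 0ℚ js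
        go (_ ∷ _)  (here refl)   = T⇒≤-if-⊔ (ℕₚ.<⇒<ᵇ j<k)
        go (i ∷ js) (there j∈js) = ≤-trans (go js j∈js) (≤-if-⊔ (toℕ i ℕ.<ᵇ toℕ k) (y i))

  module _ (valid : ValidInstance) where

    w-pos : ∀ r → 0ℚ < w r
    w-pos r = proj₁ (proj₁ (proj₂ valid) r)

    h-pos : ∀ r → 0ℚ < h r
    h-pos r = proj₂ (proj₂ valid) r

    w-nonneg : ∀ r → 0ℚ ≤ℚ w r
    w-nonneg r = <⇒≤ (w-pos r)

    F-fits : ∀ {a} → IsFQWOrdering a → prefixSum a ≤ℚ W
    F-fits {a} ((σ , _ , F⇔greedy) , _) = ≤-trans
      (prefixSum≤sumOver w-nonneg a (greedy 0ℚ σ) (λ i i<a → Equivalence.from (F⇔greedy i) i<a))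
      (subst (_≤ℚ W) (+-identityˡ _) (greedy-fits 0ℚ σ (<⇒≤ (proj₁ valid))))

    module _ {x y : Fin n → ℚ} where
      open Packing x y
      open Geometry x y

      crossing⇒overlap : ∀ {r X Y j} → Crossing r X Y j → OpenOverlap r X Y j
      crossing⇒overlap {r} {X} {Y} {j} ((xj<X+w , X<xj+w) , (yj<Y+h , Y<yj+h))
        with p , (X<p , p<X+w) , (xj<p , p<xj+w) ← intervals-meet (p<p+q X (w-pos r)) (p<p+q (x j) (w-pos j)) X<xj+w xj<X+w
           | q , (Y<q , q<Y+h) , (yj<q , q<yj+h) ← intervals-meet (p<p+q Y (h-pos r)) (p<p+q (y j) (h-pos j)) Y<yj+h yj<Y+h
        = p , q , (X<p , p<X+w , Y<q , q<Y+h) , (xj<p , p<xj+w , yj<q , q<yj+h)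

      module BottomLeft (bl : IsBL) where

        x-nonneg : ∀ r → 0ℚ ≤ℚ x r
        x-nonneg r = proj₁ (proj₁ (bl r))

        right-edge≤W : ∀ r → x r + w r ≤ℚ W
        right-edge≤W r = proj₁ (proj₂ (proj₁ (bl r)))

        y-nonneg : ∀ r → 0ℚ ≤ℚ y r
        y-nonneg r = proj₁ (proj₂ (proj₂ (proj₁ (bl r))))

        placed-apart : ∀ {j r} → j <ᶠ r → ¬ Crossing r (x r) (y r) j
        placed-apart {j} {r} j<r cross = proj₂ (proj₂ (proj₂ (proj₁ (bl r)))) j j<r (crossing⇒overlap cross)

        ¬feasible-below : ∀ {r X Y} → FeasibleAt r X Y → ¬ Y < y r
        ¬feasible-below {r} {X} {Y} feasible Y<yr with proj₂ (bl r) X Y feasible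
        ... | inj₁ yr<Y        = <-asym yr<Y Y<yr
        ... | inj₂ (yr≡Y , _) = <-irrefl (sym yr≡Y) Y<yr

        ¬feasible-left : ∀ {r X} → FeasibleAt r X (y r) → ¬ X < x r
        ¬feasible-left {r} {X} feasible X<xr with proj₂ (bl r) X (y r) feasible
        ... | inj₁ yr<yr       = <-irrefl refl yr<yr
        ... | inj₂ (_ , xr≤X) = <-irrefl refl (<-≤-trans X<xr xr≤X)

        first-fit-on-floor : ∀ {a} → prefixSum a ≤ℚ W →
                             ∀ r → toℕ r ℕ.< a → x r ≤ℚ prefixSum (toℕ r) × y r ≡ 0ℚ
        first-fit-on-floor {a} fits = All.wfRec Fin.<-wellFounded 0ℓ OnFloor place
          where
            OnFloor : Fin n → Set
            OnFloor r = toℕ r ℕ.< a → x r ≤ℚ prefixSum (toℕ r) × y r ≡ 0ℚ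

            place : ∀ r → WfRec _<ᶠ_ OnFloor r → OnFloor r
            place r earlier r<a with proj₂ (bl r) (prefixSum (toℕ r)) 0ℚ feasible
              where
                clear-of : ∀ j → j <ᶠ r → ¬ OpenOverlap r (prefixSum (toℕ r)) 0ℚ j
                clear-of j j<r overlaps = <-irrefl refl (<-≤-trans X<right-edge (begin
                  x j + w j                 ≤⟨ +-monoˡ-≤ (w j) (proj₁ (earlier j<r (ℕₚ.<-trans j<r r<a))) ⟩
                  prefixSum (toℕ j) + w j   ≡⟨ sym (prefixSum-suc j) ⟩
                  prefixSum (suc (toℕ j))   ≤⟨ prefixSum-mono w-nonneg j<r ⟩
                  prefixSum (toℕ r)         ∎))
                  where
                    open ≤-Reasoning
                    X<right-edge : prefixSum (toℕ r) < x j + w j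
                    X<right-edge = proj₂ (proj₁ (overlap⇒crossing overlaps))

                feasible : FeasibleAt r (prefixSum (toℕ r)) 0ℚ
                feasible = prefixSum-mono w-nonneg (ℕ.z≤n {toℕ r})
                         , subst (_≤ℚ W) (prefixSum-suc r) (≤-trans (prefixSum-mono w-nonneg r<a) fits)
                         , ≤-refl
                         , clear-of
            ... | inj₁ yr<0            = ⊥-elim (<-irrefl refl (≤-<-trans (y-nonneg r) yr<0))
            ... | inj₂ (yr≡0 , xr≤P) = xr≤P , yr≡0

        module _ {m : Fin n} (xm>0 : 0ℚ < x m) where

          SlidesPast : Fin n → ℚ → Set
          SlidesPast j b = ∀ X → b ≤ℚ X → X < x m → ¬ Crossing m X (y m) j

          supporter-or-slides-past : ∀ j → j <ᶠ m → LeftSupporter j m ⊎ ∃ λ b → b < x m × SlidesPast j b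
          supporter-or-slides-past j j<m with y j <? y m + h m | y m <? y j + h j
          ... | no yj≮top | _ = inj₂ (0ℚ , xm>0 , λ _ _ _ (_ , (yj<top , _)) → yj≮top yj<top)
          ... | yes _ | no ym≮top = inj₂ (0ℚ , xm>0 , λ _ _ _ (_ , (_ , ym<top)) → ym≮top ym<top)
          ... | yes yj<topm | yes ym<topj with <-cmp (x j + w j) (x m)
          ... | tri< edge<xm _ _ =
            inj₂ (x j + w j , edge<xm , λ _ edge≤X _ ((_ , X<edge) , _) → <-irrefl refl (<-≤-trans X<edge edge≤X))
          ... | tri≈ _ edge≡xm _ =
            inj₁ (j<m , edge≡xm , intervals-meet (p<p+q (y j) (h-pos j)) (p<p+q (y m) (h-pos m)) yj<topm ym<topj)
          ... | tri> _ _ edge>xm with x j <? x m + w m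
          ... | yes xj<right = ⊥-elim (placed-apart j<m ((xj<right , edge>xm) , (yj<topm , ym<topj)))
          ... | no xj≮right =
            inj₂ (0ℚ , xm>0 , λ X _ X<xm ((xj<X+w , _) , _) → xj≮right (<-trans xj<X+w (+-monoˡ-< (w m) X<xm)))

          supporter-or-all-slide-past : ∀ js → (∃ λ j → LeftSupporter j m) ⊎
            ∃ λ b → 0ℚ ≤ℚ b × b < x m × (∀ j → j ∈ js → j <ᶠ m → SlidesPast j b)
          supporter-or-all-slide-past [] = inj₂ (0ℚ , ≤-refl , xm>0 , λ _ ())
          supporter-or-all-slide-past (j ∷ js) with supporter-or-all-slide-past js
          ... | inj₁ supporter = inj₁ supporter
          ... | inj₂ (b , 0≤b , b<xm , past) with toℕ j ℕ.<? toℕ m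
          ... | no j≮m = inj₂ (b , 0≤b , b<xm , λ { _ (here refl) j<m → ⊥-elim (j≮m j<m) ; i (there i∈js) → past i i∈js })
          ... | yes j<m with supporter-or-slides-past j j<m
          ... | inj₁ supporter = inj₁ (j , supporter)
          ... | inj₂ (bj , bj<xm , j-past) = inj₂ (b ⊔ bj , ≤-trans 0≤b (p≤p⊔q b bj) , ⊔-<-lub b<xm bj<xm , both-past)
            where
              both-past : ∀ i → i ∈ j ∷ js → i <ᶠ m → SlidesPast i (b ⊔ bj)
              both-past _ (here refl)   _   X b⊔bj≤X = j-past X (≤-trans (p≤q⊔p b bj) b⊔bj≤X)
              both-past i (there i∈js) i<m X b⊔bj≤X = past i i∈js i<m X (≤-trans (p≤p⊔q b bj) b⊔bj≤X)

          left-supporter : ∃ λ j → LeftSupporter j m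
          left-supporter with supporter-or-all-slide-past (allFin n)
          ... | inj₁ supporter = supporter
          ... | inj₂ (b , 0≤b , b<xm , past) = ⊥-elim (¬feasible-left feasible b<xm)
            where
              feasible : FeasibleAt m b (y m)
              feasible = 0≤b
                       , ≤-trans (+-monoˡ-≤ (w m) (<⇒≤ b<xm)) (right-edge≤W m)
                       , y-nonneg m
                       , λ j j<m j-overlaps → past j (∈-allFin j) j<m b ≤-refl b<xm (overlap⇒crossing j-overlaps)

        module LeftmostOfType {a : ℕ} (fqw : IsFQWOrdering a) {L : Fin n} (isL : IsLeft a L)
                              {c : ℚ} {k : Fin n} (a<k : suc a ≤ toℕ k) (k≤L : toℕ k ≤ toℕ L)
                              (strip : InStrip k c) {m : Fin n} (lm : IsLM a c m) where

          Q-by-width : ∀ i j → inQ a i → inQ a j → i <ᶠ j → w j ≤ℚ w i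
          Q-by-width = proj₁ (proj₂ (proj₂ fqw))

          L∈Q : inQ a L
          L∈Q = [ proj₁ , (λ (_ , L∈Q , _) → L∈Q) ]′ isL

          Q-up-to-L : ∀ {i} → toℕ i ≤ toℕ L → ¬ inF a i → inQ a i
          Q-up-to-L i≤L i∉F = i∉F , λ i-wide → ℕₚ.<⇒≱ (proj₂ (proj₂ (proj₂ fqw)) L _ L∈Q (i∉F , i-wide)) i≤L

          below-line : ∀ {j} → j <ᶠ k → y j ≤ℚ c
          below-line j<k = ≤-trans (y≤maxPrev j<k) (proj₁ strip)

          k≤above-line : ∀ {r} → c < y r → toℕ k ≤ toℕ r
          k≤above-line c<yr = ℕₚ.≮⇒≥ λ r<k → <-irrefl refl (<-≤-trans c<yr (below-line r<k))

          in-type : ∀ {i} → inQ a i → i <ᶠ k → c < y i + h i → InType a c i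
          in-type i∈Q i<k c<top = i∈Q , (below-line i<k , <⇒≤ c<top) , λ _ c<yr → ℕₚ.<-≤-trans i<k (k≤above-line c<yr)

          LM-leftmost : ∀ {i} → inQ a i → i <ᶠ k → c < y i + h i → x m ≤ℚ x i
          LM-leftmost i∈Q i<k c<top = proj₂ lm _ (in-type i∈Q i<k c<top)

          m∈Q : inQ a m
          m∈Q = proj₁ (proj₁ lm)

          m<k : m <ᶠ k
          m<k = proj₂ (proj₂ (proj₁ lm)) k (proj₂ strip)

          k∈Q : inQ a k
          k∈Q = Q-up-to-L k≤L (λ k<a → ℕₚ.<-asym k<a a<k)

          LM-off-wall : 0ℚ < x m
          LM-off-wall = ≰⇒> λ xm≤0 → xm≢0 (≤-antisym xm≤0 (x-nonneg m))
            where
              xm≢0 : x m ≢ 0ℚ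
              xm≢0 = [ (λ (_ , _ , L-first) xm≡0 → ℕₚ.<⇒≱ (ℕₚ.<-≤-trans m<k k≤L) (L-first m m∈Q xm≡0))
                     , (λ (off-wall , _) → off-wall m m∈Q) ]′ isL

          ¬supporter∉F : ∀ {j} → LeftSupporter j m → ¬ ¬ inF a j
          ¬supporter∉F {j} (j<m , touch , _) j∉F = ¬feasible-below k-fits (proj₂ strip)
            where
              j<k : j <ᶠ k
              j<k = ℕₚ.<-trans j<m m<k

              j∈Q : inQ a j
              j∈Q = Q-up-to-L (ℕₚ.<⇒≤ (ℕₚ.<-≤-trans j<k k≤L)) j∉F

              top-j≤c : y j + h j ≤ℚ c
              top-j≤c = ≮⇒≥ λ c<top → <-irrefl refl (<-≤-trans (subst (x j <_) touch (p<p+q (x j) (w-pos j)))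
                                                                (LM-leftmost j∈Q j<k c<top))

              wk≤wj : w k ≤ℚ w j
              wk≤wj = ≤-trans (Q-by-width m k m∈Q k∈Q m<k) (Q-by-width j m j∈Q m∈Q j<m)

              k-right-edge : x j + w k ≤ℚ x m
              k-right-edge = subst (x j + w k ≤ℚ_) touch (+-monoʳ-≤ (x j) wk≤wj)

              yj<top-j : y j < y j + h j
              yj<top-j = p<p+q (y j) (h-pos j)

              k-misses : ∀ i → i <ᶠ k → ¬ Crossing k (x j) c i
              k-misses i i<k ((xi<right , xj<xi+w) , (_ , c<top-i)) with toℕ i ℕ.<? a
              -- i would belong to T(ℓ) and lie left of LM(ℓ)
              ... | no i∉F = <-irrefl refl (<-≤-trans (<-≤-trans xi<right k-right-edge)
                (LM-leftmost (Q-up-to-L (ℕₚ.<⇒≤ (ℕₚ.<-≤-trans i<k k≤L)) i∉F) i<k c<top-i))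
              -- i stands on the floor and reaches above ℓ, so it would meet j
              ... | yes i∈F = placed-apart (ℕₚ.<-≤-trans i∈F (ℕₚ.≮⇒≥ j∉F))
                  ( (<-≤-trans xi<right (+-monoʳ-≤ (x j) wk≤wj) , xj<xi+w)
                  , (subst (_< y j + h j) (sym yi≡0) (≤-<-trans (y-nonneg j) yj<top-j)
                    , <-trans (<-≤-trans yj<top-j top-j≤c) c<top-i) )
                where
                  yi≡0 : y i ≡ 0ℚ
                  yi≡0 = proj₂ (first-fit-on-floor (F-fits fqw) i i∈F)

              k-fits : FeasibleAt k (x j) c
              k-fits = x-nonneg j
                     , ≤-trans k-right-edge (≤-trans (<⇒≤ (p<p+q (x m) (w-pos m))) (right-edge≤W m))
                     , ≤-trans (y-nonneg m) (proj₁ (proj₁ (proj₂ (proj₁ lm))))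
                     , λ i i<k i-overlaps → k-misses i i<k (overlap⇒crossing i-overlaps)

          supporter∈F : ∀ {j} → LeftSupporter j m → inF a j
          supporter∈F {j} supports with toℕ j ℕ.<? a
          ... | yes j∈F = j∈F
          ... | no  j∉F = ⊥-elim (¬supporter∉F supports j∉F)

lemma11 : {n : ℕ} (W : ℚ) (w h : Fin n → ℚ) (x y : Fin n → ℚ) (a : ℕ) →
    Strip.ValidInstance W w h →
    Strip.IsFQWOrdering W w h a →
    Strip.Packing.IsBL W w h x y →
    (∃ λ q → Strip.inQ W w h a q) →
    (∃ λ q → Strip.inQ W w h a q × Strip.hmax W w h < Strip.Packing.top W w h x y q) →
    (L : Fin n) → Strip.Packing.IsLeft W w h x y a L →
    (c : ℚ) → Strip.Packing.Proper W w h x y c →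
    (k : Fin n) → suc a ≤ toℕ k → toℕ k ≤ toℕ L →
    Strip.Packing.InStrip W w h x y k c →
    (m : Fin n) → Strip.Packing.IsLM W w h x y a c m →
    ∃ λ j → Strip.inF W w h a j × Strip.Packing.LeftSupporter W w h x y j m
lemma11 W w h x y a valid fqw bl _ _ L isL c _ k a<k k≤L strip m lm =
  let open BottomLeft W w h valid bl
      open LeftmostOfType fqw isL a<k k≤L strip lm
      (j , supports) = left-supporter LM-off-wall
  in j , supporter∈F supports , supports
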